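{- Let $n\ge1$ and $k\ge 1$ be integers. If $X^n-1$ has a factor in $\mathbb F_2[X]$ of the form $X^k+a_{k-1}X^{k-1}+\cdots+a_2X^2+a_0$ (with $a_i\in\mathbb F_2$, i.e. the coefficient of $X$ is zero), then $F_{\mathrm{inv}}$ over $\mathbb F_{2^n}$ is not $k$th order sum-free.
   Context: $F_{\mathrm{inv}}:\mathbb F_{2^n}\to\mathbb F_{2^n}$ is defined by $F_{\mathrm{inv}}(x)=x^{2^n-2}$ (so $F_{\mathrm{inv}}(x)=x^{ -1}$ for $x\ne0$ and $F_{\mathrm{inv}}(0)=0$). For an integer $0\le k\le n$, a function $F:\mathbb F_{2^n}\to\mathbb F_{2^n}$ is called $k$th order sum-free if $\sum_{x\in A}F(x)\ne 0$ for every $k$-dimensional affine $\mathbb F_2$-subspace $A$ of $\mathbb F_{2^n}$. -}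

module Defs where

open import Data.Bool using (Bool; true; false; _xor_; if_then_else_)
open import Data.Nat using (ℕ; zero; suc; _∸_; _^_; _≡ᵇ_)
open import Data.List using (List; []; _∷_; _++_; map; foldr)
open import Data.Vec using (Vec; []; _∷_; replicate; zipWith; tabulate; toList)
open import Data.Fin using (Fin; toℕ)
open import Data.Product using (∃; _×_; _,_)
open import Relation.Binary.PropositionalEquality using (_≡_; _≢_)

-- Polynomials over F₂ = Bool (xor = +, ∧ = ·), as coefficient lists,
-- lowest degree first.  Trailing zeros are allowed; equality of
-- polynomials is coefficientwise (via `coeff`).

polyAdd : List Bool → List Bool → List Bool
polyAdd [] q = q
polyAdd (a ∷ p) [] = a ∷ p
polyAdd (a ∷ p) (b ∷ q) = (a xor b) ∷ polyAdd p q

polyMul : List Bool → List Bool → List Bool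
polyMul [] q = []
polyMul (a ∷ p) q = polyAdd (if a then q else []) (false ∷ polyMul p q)

coeff : List Bool → ℕ → Bool
coeff [] i = false
coeff (a ∷ p) zero = a
coeff (a ∷ p) (suc i) = coeff p i

coeffXn-1 : ℕ → ℕ → Bool
coeffXn-1 n i = (i ≡ᵇ 0) xor (i ≡ᵇ n)

DividesXn-1 : ℕ → List Bool → Set
DividesXn-1 n g = ∃ λ (h : List Bool) → ∀ i → coeff (polyMul g h) i ≡ coeffXn-1 n i

monic : ∀ {k} → Vec Bool k → List Bool
monic c = toList c ++ (true ∷ [])

-- The ring F₂[X]/(p), p = X^n + p_{n-1}X^{n-1} + ... + p_0 (given by the
-- vector of its lower coefficients).  Elements: Vec Bool n, coefficients
-- of 1, α, ..., α^{n-1} where α = X mod p.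

El : ℕ → Set
El n = Vec Bool n

zeroE : ∀ {n} → El n
zeroE = replicate _ false

oneE : ∀ {n} → El n
oneE = tabulate (λ i → toℕ i ≡ᵇ 0)

_⊕_ : ∀ {n} → El n → El n → El n
_⊕_ = zipWith _xor_

scale : ∀ {n} → Bool → El n → El n
scale b x = if b then x else zeroE

shiftAux : ∀ {n} → Bool → El n → El n × Bool
shiftAux c [] = [] , c
shiftAux c (x ∷ xs) with shiftAux x xs
... | ys , o = (c ∷ ys) , o

mulα : ∀ {n} → El n → El n → El n
mulα p x with shiftAux false x
... | ys , o = ys ⊕ scale o p

mulAux : ∀ {n m} → El n → El n → Vec Bool m → El n
mulAux p x [] = zeroE
mulAux p x (b ∷ bs) = scale b x ⊕ mulAux p (mulα p x) bs

mulE : ∀ {n} → El n → El n → El n → El n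
mulE p x y = mulAux p x y

powE : ∀ {n} → El n → El n → ℕ → El n
powE p x zero = oneE
powE p x (suc e) = mulE p x (powE p x e)

-- F₂[X]/(p) is a field (equivalently p is irreducible); then it is F_{2^n}
IsField : ∀ {n} → El n → Set
IsField {n} p = (x : El n) → x ≢ zeroE → ∃ λ (y : El n) → mulE p x y ≡ oneE

Finv : ∀ {n} → El n → El n → El n
Finv {n} p x = powE p x (2 ^ n ∸ 2)

comb : ∀ {n k} → Vec (El n) k → Vec Bool k → El n
comb [] [] = zeroE
comb (v ∷ vs) (b ∷ bs) = scale b v ⊕ comb vs bs

LinIndep : ∀ {n k} → Vec (El n) k → Set
LinIndep {k = k} vs = (c : Vec Bool k) → c ≢ replicate k false → comb vs c ≢ zeroE

allVecs : (k : ℕ) → List (Vec Bool k)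
allVecs zero = [] ∷ []
allVecs (suc k) = map (false ∷_) (allVecs k) ++ map (true ∷_) (allVecs k)

sumE : ∀ {n} → List (El n) → El n
sumE = foldr _⊕_ zeroE

affineSum : ∀ {n k} → (El n → El n) → El n → Vec (El n) k → El n
affineSum {k = k} F a vs = sumE (map (λ c → F (a ⊕ comb vs c)) (allVecs k))

-- F is k-th order sum-free: Σ_{x∈A} F(x) ≠ 0 for every k-dim affine subspace A
-- (every such A is a + span(v₁,…,v_k) with v linearly independent)
SumFree : ∀ {n} → ℕ → (El n → El n) → Set
SumFree {n} k F = (a : El n) (vs : Vec (El n) k) → LinIndep vs → affineSum F a vs ≢ zeroE

{-# OPTIONS --safe #-}
-- Write the factor as g = 1 + X² r (its constant term is 1 since g divides
-- Xⁿ + 1) and let h be the cofactor, of degree m = n - k.  On F_{2ⁿ} = F₂[X]/(p)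
-- the linearised polynomials L_q(x) = Σ qᵢ x^(2ⁱ) satisfy L_g ∘ L_h = L_{Xⁿ+1} = 0
-- by Fermat.  L_h is a monic polynomial of degree 2^m, so its kernel has
-- dimension at most m and its image, contained in ker L_g, has dimension at
-- least k.  Every e ∈ ker L_g satisfies e = L_r(e⁴), hence for e ≠ 0
--   e⁻¹ = e⁻² L_r(e⁴) = Σ rᵢ e^(2^(i+2) - 2),   e^(2^(i+2) - 2) = e² e⁴ ⋯ e^(2^(i+1)),
-- a polynomial of algebraic degree at most deg r + 1 = k - 1 in e.  A function of
-- algebraic degree below k sums to zero over every k-dimensional subspace, so
-- F_inv sums to zero over a k-dimensional subspace of ker L_g.

module Submission where

open import Defs

open import Algebra.Bundles using (CommutativeSemiring; CommutativeRing)
open import Algebra.Structures using (IsCommutativeMonoid)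
open import Algebra.Structures.Biased using (isCommutativeSemiringˡ)
open import Algebra.Solver.Ring.AlmostCommutativeRing
  using (fromCommutativeSemiring; _-Raw-AlmostCommutative⟶_)
import Algebra.Solver.Ring as RingSolver
open import Data.Bool using (Bool; true; false; _xor_; _∧_; if_then_else_; T)
import Data.Bool as Bool
open import Data.Bool.Properties
  using (∧-zeroʳ; ∧-identityʳ; xor-assoc; xor-comm; xor-same; xor-identityʳ; xor-∧-commutativeRing)
open import Data.Empty using (⊥-elim)
open import Data.Maybe using (Maybe; just; nothing)
open import Data.Nat
  using (ℕ; zero; suc; pred; _+_; _∸_; _^_; _≡ᵇ_; _≤_; _<_; z≤n; s≤s; s≤s⁻¹
        ; _≤′_; ≤′-refl; ≤′-step)
open import Data.Nat.Properties
  using ( ≤-refl; ≤-reflexive; ≤-trans; ≤⇒≤′; ≮⇒≥; <⇒≱; n≤1+n; m≤m+n; m≤n+m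
        ; +-identityʳ; +-suc; +-monoʳ-≤; +-cancelʳ-≤; m∸n+n≡m; m<n⇒0<n∸m
        ; ^-monoʳ-≤; ^-monoʳ-<; m^n≢0; suc-pred; ≡ᵇ⇒≡; module ≤-Reasoning )
open import Data.Product using (_×_; _,_; proj₁; proj₂; ∃; ∃₂; uncurry)
open import Data.Sum using (_⊎_; inj₁; inj₂; [_,_]′)
open import Data.Unit using (tt)
open import Data.Vec using (Vec; []; _∷_; tabulate)
import Data.Vec as Vec
open import Data.Vec.Properties
  using (∷-injectiveʳ; length-toList; ≡-dec; zipWith-assoc; zipWith-comm; zipWith-identityˡ; zipWith-identityʳ)
open import Data.Vec.Relation.Unary.All using ([]; _∷_) renaming (All to VAll)
import Data.Vec.Relation.Unary.All as VAll
import Data.Vec.Relation.Unary.All.Properties as VAll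
open import Data.List using (List; []; _∷_; _++_; map; length)
import Data.List as List
open import Data.List.Properties using (length-++; length-map; map-++; map-∘; map-cong)
open import Data.List.Membership.Propositional using (_∈_; lose)
open import Data.List.Membership.Propositional.Properties using (∈-map⁺; ∈-map⁻; ∈-++⁺ˡ; ∈-++⁺ʳ)
open import Data.List.Membership.Propositional.Properties.WithK using (unique∧set⇒bag)
open import Data.List.Relation.Binary.BagAndSetEquality using (∼bag⇒↭)
open import Data.List.Relation.Binary.Permutation.Propositional using (_↭_; ↭⇒↭ₛ)
import Data.List.Relation.Binary.Permutation.Setoid.Properties as Permutation
open import Data.List.Relation.Unary.All using (All; []; _∷_)
import Data.List.Relation.Unary.All as All
import Data.List.Relation.Unary.All.Properties as All
open import Data.List.Relation.Unary.AllPairs using ([]; _∷_)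
import Data.List.Relation.Unary.AllPairs as AllPairs
open import Data.List.Relation.Unary.Any using (here; there; any?; satisfied)
open import Data.List.Relation.Unary.Unique.Propositional using (Unique)
import Data.List.Relation.Unary.Unique.Propositional.Properties as Unique
open import Function using (_∘_; id; case_of_; _⟨_⟩_)
open import Function.Bundles using (mk⇔)
open import Level using (0ℓ)
open import Relation.Nullary using (¬_; Dec; yes; no)
open import Relation.Binary.PropositionalEquality
open import Relation.Binary.PropositionalEquality.Algebra using (isMagma)
open import Relation.Binary.PropositionalEquality.Properties using (setoid)

-- The F₂-vector space El n

⊕-assoc : ∀ {n} (x y z : El n) → (x ⊕ y) ⊕ z ≡ x ⊕ (y ⊕ z)
⊕-assoc = zipWith-assoc xor-assoc

⊕-comm : ∀ {n} (x y : El n) → x ⊕ y ≡ y ⊕ x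
⊕-comm = zipWith-comm xor-comm

⊕-identityˡ : ∀ {n} (x : El n) → zeroE ⊕ x ≡ x
⊕-identityˡ = zipWith-identityˡ (λ _ → refl)

⊕-identityʳ : ∀ {n} (x : El n) → x ⊕ zeroE ≡ x
⊕-identityʳ = zipWith-identityʳ xor-identityʳ

⊕-same : ∀ {n} (x : El n) → x ⊕ x ≡ zeroE
⊕-same [] = refl
⊕-same (a ∷ x) = cong₂ _∷_ (xor-same a) (⊕-same x)

⊕-interchange : ∀ {n} (a b c d : El n) → (a ⊕ b) ⊕ (c ⊕ d) ≡ (a ⊕ c) ⊕ (b ⊕ d)
⊕-interchange a b c d = begin
  (a ⊕ b) ⊕ (c ⊕ d) ≡⟨ ⊕-assoc a b (c ⊕ d) ⟩
  a ⊕ (b ⊕ (c ⊕ d)) ≡⟨ cong (a ⊕_) (sym (⊕-assoc b c d)) ⟩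
  a ⊕ ((b ⊕ c) ⊕ d) ≡⟨ cong (λ t → a ⊕ (t ⊕ d)) (⊕-comm b c) ⟩
  a ⊕ ((c ⊕ b) ⊕ d) ≡⟨ cong (a ⊕_) (⊕-assoc c b d) ⟩
  a ⊕ (c ⊕ (b ⊕ d)) ≡⟨ sym (⊕-assoc a c (b ⊕ d)) ⟩
  (a ⊕ c) ⊕ (b ⊕ d) ∎
  where open ≡-Reasoning

⊕-cancelʳ : ∀ {n} (x y : El n) → (x ⊕ y) ⊕ y ≡ x
⊕-cancelʳ x y = trans (⊕-assoc x y y) (trans (cong (x ⊕_) (⊕-same y)) (⊕-identityʳ x))

⊕≡zero⇒≡ : ∀ {n} {x y : El n} → x ⊕ y ≡ zeroE → x ≡ y
⊕≡zero⇒≡ {x = x} {y} e = trans (sym (⊕-cancelʳ x y)) (trans (cong (_⊕ y) e) (⊕-identityˡ y))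

⊕-isCommutativeMonoid : ∀ {n} → IsCommutativeMonoid _≡_ (_⊕_ {n}) zeroE
⊕-isCommutativeMonoid = record
  { isMonoid = record
    { isSemigroup = record { isMagma = isMagma _⊕_ ; assoc = ⊕-assoc }
    ; identity = ⊕-identityˡ , ⊕-identityʳ
    }
  ; comm = ⊕-comm
  }

scale-distrib-⊕ : ∀ {n} b (x y : El n) → scale b (x ⊕ y) ≡ scale b x ⊕ scale b y
scale-distrib-⊕ true x y = refl
scale-distrib-⊕ false x y = sym (⊕-identityʳ zeroE)

scale-xor : ∀ {n} a b (x : El n) → scale (a xor b) x ≡ scale a x ⊕ scale b x
scale-xor true true x = sym (⊕-same x)
scale-xor true false x = sym (⊕-identityʳ x)
scale-xor false b x = sym (⊕-identityˡ _)

scale-zeroE : ∀ {n} b → scale b (zeroE {n}) ≡ zeroE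
scale-zeroE true = refl
scale-zeroE false = refl

scale-∷ : ∀ {n} b a (x : El n) → scale b (a ∷ x) ≡ (b ∧ a) ∷ scale b x
scale-∷ true a x = refl
scale-∷ false a x = refl

module AdditiveMap {n m : ℕ} (T : El n → El m)
  (T-⊕ : ∀ x y → T (x ⊕ y) ≡ T x ⊕ T y) where

  T-zeroE : T zeroE ≡ zeroE
  T-zeroE = trans (cong T (sym (⊕-same zeroE))) (trans (T-⊕ zeroE zeroE) (⊕-same (T zeroE)))

  T-scale : ∀ b x → T (scale b x) ≡ scale b (T x)
  T-scale true x = refl
  T-scale false x = T-zeroE

  T-comb : ∀ {k} (vs : Vec (El n) k) c → T (comb vs c) ≡ comb (Vec.map T vs) c
  T-comb [] [] = T-zeroE
  T-comb (v ∷ vs) (a ∷ c) = trans (T-⊕ _ _) (cong₂ _⊕_ (T-scale a v) (T-comb vs c))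

  T-comb-kernel : ∀ {k} {vs : Vec (El n) k} → VAll (λ v → T v ≡ zeroE) vs → ∀ c → T (comb vs c) ≡ zeroE
  T-comb-kernel [] [] = T-zeroE
  T-comb-kernel {vs = v ∷ vs} (Tv≡0 ∷ Tvs≡0) (a ∷ c) = begin
    T (scale a v ⊕ comb vs c)       ≡⟨ T-⊕ (scale a v) (comb vs c) ⟩
    T (scale a v) ⊕ T (comb vs c)   ≡⟨ cong₂ _⊕_ (T-scale a v) (T-comb-kernel Tvs≡0 c) ⟩
    scale a (T v) ⊕ zeroE           ≡⟨ cong (λ t → scale a t ⊕ zeroE) Tv≡0 ⟩
    scale a zeroE ⊕ zeroE           ≡⟨ cong (_⊕ zeroE) (scale-zeroE a) ⟩
    zeroE ⊕ zeroE                   ≡⟨ ⊕-same zeroE ⟩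
    zeroE                           ∎
    where open ≡-Reasoning

-- Enumerating F₂ᵏ

allVecs-complete : ∀ {m} (x : Vec Bool m) → x ∈ allVecs m
allVecs-complete [] = here refl
allVecs-complete {suc m} (false ∷ x) = ∈-++⁺ˡ (∈-map⁺ (false ∷_) (allVecs-complete x))
allVecs-complete {suc m} (true ∷ x) =
  ∈-++⁺ʳ (map (false ∷_) (allVecs m)) (∈-map⁺ (true ∷_) (allVecs-complete x))

allVecs-unique : ∀ m → Unique (allVecs m)
allVecs-unique zero = [] ∷ []
allVecs-unique (suc m) =
  Unique.++⁺ (Unique.map⁺ ∷-injectiveʳ (allVecs-unique m)) (Unique.map⁺ ∷-injectiveʳ (allVecs-unique m)) disjoint
  where
  disjoint : ∀ {v} → ¬ (v ∈ map (false ∷_) (allVecs m) × v ∈ map (true ∷_) (allVecs m))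
  disjoint (v∈₀ , v∈₁) with ∈-map⁻ (false ∷_) v∈₀ | ∈-map⁻ (true ∷_) v∈₁
  ... | _ , _ , refl | _ , _ , ()

length-allVecs : ∀ m → length (allVecs m) ≡ 2 ^ m
length-allVecs zero = refl
length-allVecs (suc m) = begin
  length (map (false ∷_) (allVecs m) ++ map (true ∷_) (allVecs m))
    ≡⟨ length-++ (map (false ∷_) (allVecs m)) ⟩
  length (map (false ∷_) (allVecs m)) + length (map (true ∷_) (allVecs m))
    ≡⟨ cong₂ _+_ (length-map _ (allVecs m)) (length-map _ (allVecs m)) ⟩
  length (allVecs m) + length (allVecs m)
    ≡⟨ cong₂ _+_ (length-allVecs m) (trans (length-allVecs m) (sym (+-identityʳ (2 ^ m)))) ⟩
  2 ^ suc m ∎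
  where open ≡-Reasoning

nonzeroVecs : (m : ℕ) → List (Vec Bool m)
nonzeroVecs m = List.drop 1 (allVecs m)

allVecs≡zeroE∷nonzeroVecs : ∀ m → allVecs m ≡ zeroE ∷ nonzeroVecs m
allVecs≡zeroE∷nonzeroVecs zero = refl
allVecs≡zeroE∷nonzeroVecs (suc m) rewrite allVecs≡zeroE∷nonzeroVecs m = refl

nonzeroVecs-unique : ∀ m → Unique (nonzeroVecs m)
nonzeroVecs-unique m with allVecs-unique m
... | uniq rewrite allVecs≡zeroE∷nonzeroVecs m = AllPairs.tail uniq

nonzeroVecs-nonzero : ∀ m → All (_≢ zeroE) (nonzeroVecs m)
nonzeroVecs-nonzero m with allVecs-unique m
... | uniq rewrite allVecs≡zeroE∷nonzeroVecs m = All.map ≢-sym (AllPairs.head uniq)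

∈-nonzeroVecs : ∀ {m} {x : Vec Bool m} → x ≢ zeroE → x ∈ nonzeroVecs m
∈-nonzeroVecs {m} {x} x≢0 with subst (x ∈_) (allVecs≡zeroE∷nonzeroVecs m) (allVecs-complete x)
... | here x≡0 = ⊥-elim (x≢0 x≡0)
... | there x∈ = x∈

length-nonzeroVecs : ∀ m → suc (length (nonzeroVecs m)) ≡ 2 ^ m
length-nonzeroVecs m = trans (cong length (sym (allVecs≡zeroE∷nonzeroVecs m))) (length-allVecs m)

_≟_ : ∀ {n} → (x y : El n) → Dec (x ≡ y)
_≟_ = ≡-dec Bool._≟_

-- Linear independence and spans

module _ {n : ℕ} where

  comb-⊕ : ∀ {k} (vs : Vec (El n) k) c c' → comb vs (c ⊕ c') ≡ comb vs c ⊕ comb vs c'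
  comb-⊕ [] [] [] = sym (⊕-identityʳ zeroE)
  comb-⊕ (v ∷ vs) (a ∷ c) (b ∷ c') = begin
    scale (a xor b) v ⊕ comb vs (c ⊕ c')
      ≡⟨ cong₂ _⊕_ (scale-xor a b v) (comb-⊕ vs c c') ⟩
    (scale a v ⊕ scale b v) ⊕ (comb vs c ⊕ comb vs c')
      ≡⟨ ⊕-interchange _ _ _ _ ⟩
    comb (v ∷ vs) (a ∷ c) ⊕ comb (v ∷ vs) (b ∷ c') ∎
    where open ≡-Reasoning

  comb-zeroE : ∀ {k} (vs : Vec (El n) k) → comb vs zeroE ≡ zeroE
  comb-zeroE vs = AdditiveMap.T-zeroE (comb vs) (comb-⊕ vs)

  comb-injective : ∀ {k} {vs : Vec (El n) k} → LinIndep vs → ∀ {c c'} → comb vs c ≡ comb vs c' → c ≡ c'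
  comb-injective {vs = vs} ind {c} {c'} eq with c ≟ c'
  ... | yes c≡c' = c≡c'
  ... | no c≢c' = ⊥-elim (ind (c ⊕ c') (c≢c' ∘ ⊕≡zero⇒≡)
          (trans (comb-⊕ vs c c') (trans (cong (_⊕ comb vs c') eq) (⊕-same _))))

  LinIndep-tail : ∀ {k} {v : El n} {vs : Vec (El n) k} → LinIndep (v ∷ vs) → LinIndep vs
  LinIndep-tail {v = v} ind c c≢0 eq =
    ind (false ∷ c) (c≢0 ∘ ∷-injectiveʳ) (trans (⊕-identityˡ _) eq)

  independent-subfamily : ∀ {P : El n → Set} {k r} → k ≤ r → (vs : Vec (El n) r) → LinIndep vs → VAll P vs →
    ∃ λ (us : Vec (El n) k) → LinIndep us × VAll P us
  independent-subfamily k≤r = go (≤⇒≤′ k≤r)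
    where
    go : ∀ {P : El n → Set} {k r} → k ≤′ r → (vs : Vec (El n) r) → LinIndep vs → VAll P vs →
      ∃ λ (us : Vec (El n) k) → LinIndep us × VAll P us
    go ≤′-refl vs ind P-vs = vs , ind , P-vs
    go (≤′-step k≤r) (v ∷ vs) ind (_ ∷ P-vs) = go k≤r vs (LinIndep-tail ind) P-vs

  record InSpan {j} (bs : Vec (El n) j) (v : El n) : Set where
    constructor spanned
    field
      coeffs : Vec Bool j
      comb≡ : comb bs coeffs ≡ v

  InSpan? : ∀ {j} (bs : Vec (El n) j) v → Dec (InSpan bs v)
  InSpan? {j} bs v with any? (λ c → comb bs c ≟ v) (allVecs j)
  ... | yes found = yes (uncurry spanned (satisfied found))
  ... | no none = no λ (spanned c eq) → none (lose (allVecs-complete c) eq)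

  LinIndep-∷ : ∀ {k} {v : El n} {vs : Vec (El n) k} → LinIndep vs → ¬ InSpan vs v → LinIndep (v ∷ vs)
  LinIndep-∷ ind v∉ (false ∷ c) c≢0 eq = ind c (c≢0 ∘ cong (false ∷_)) (trans (sym (⊕-identityˡ _)) eq)
  LinIndep-∷ ind v∉ (true ∷ c) c≢0 eq = v∉ (spanned c (sym (⊕≡zero⇒≡ eq)))

  LinIndep⇒∉span : ∀ {k} {v : El n} {vs : Vec (El n) k} → LinIndep (v ∷ vs) → ¬ InSpan vs v
  LinIndep⇒∉span {v = v} ind (spanned c refl) = ind (true ∷ c) (λ ()) (⊕-same v)

  InSpan-⊕ : ∀ {j} {bs : Vec (El n) j} {u v} → InSpan bs u → InSpan bs v → InSpan bs (u ⊕ v)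
  InSpan-⊕ {bs = bs} (spanned c refl) (spanned c' refl) = spanned (c ⊕ c') (comb-⊕ bs c c')

  InSpan-zeroE : ∀ {j} {bs : Vec (El n) j} → InSpan bs zeroE
  InSpan-zeroE {bs = bs} = spanned zeroE (comb-zeroE bs)

  InSpan-comb : ∀ {j k} {bs : Vec (El n) j} {as : Vec (El n) k} → VAll (InSpan bs) as → ∀ c → InSpan bs (comb as c)
  InSpan-comb [] [] = InSpan-zeroE
  InSpan-comb (a∈ ∷ as∈) (true ∷ c) = InSpan-⊕ a∈ (InSpan-comb as∈ c)
  InSpan-comb (a∈ ∷ as∈) (false ∷ c) = InSpan-⊕ InSpan-zeroE (InSpan-comb as∈ c)

  InSpan-∷ : ∀ {j} {b} {bs : Vec (El n) j} {u} → InSpan bs u → InSpan (b ∷ bs) u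
  InSpan-∷ (spanned c eq) = spanned (false ∷ c) (trans (⊕-identityˡ _) eq)

  InSpan-head : ∀ {j} {b} (bs : Vec (El n) j) → InSpan (b ∷ bs) b
  InSpan-head {b = b} bs = spanned (true ∷ zeroE) (trans (cong (b ⊕_) (comb-zeroE bs)) (⊕-identityʳ b))

-- The i-th standard basis vector, Xⁱ in F₂[X]/(p); it is zero for i ≥ m.
unitVec : (m : ℕ) → ℕ → El m
unitVec zero i = []
unitVec (suc m) zero = true ∷ zeroE
unitVec (suc m) (suc i) = false ∷ unitVec m i

unitVecs : ∀ {m} j → ℕ → Vec (El m) j
unitVecs zero i = []
unitVecs (suc j) i = unitVec _ i ∷ unitVecs j (suc i)

comb-unitVecs-suc : ∀ {m j} i (bs : Vec Bool j) →
  comb (unitVecs {suc m} j (suc i)) bs ≡ false ∷ comb (unitVecs j i) bs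
comb-unitVecs-suc i [] = refl
comb-unitVecs-suc {m} i (b ∷ bs)
  rewrite comb-unitVecs-suc {m} (suc i) bs | scale-∷ b false (unitVec m i) | ∧-zeroʳ b = refl

standardBasis : ∀ m → Vec (El m) m
standardBasis m = unitVecs m 0

comb-standardBasis : ∀ {m} (c : El m) → comb (standardBasis m) c ≡ c
comb-standardBasis [] = refl
comb-standardBasis {suc m} (b ∷ c)
  rewrite comb-unitVecs-suc {m} 0 c | comb-standardBasis c | scale-∷ b true (zeroE {m}) | scale-zeroE {m} b
        | ∧-identityʳ b | xor-identityʳ b | ⊕-identityˡ c = refl

standardBasis-independent : ∀ m → LinIndep (standardBasis m)
standardBasis-independent m c c≢0 eq = c≢0 (trans (sym (comb-standardBasis c)) eq)

module RankNullity {n m : ℕ} (T : El n → El m) (T-⊕ : ∀ x y → T (x ⊕ y) ≡ T x ⊕ T y) where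
  open AdditiveMap T T-⊕

  -- The two span conditions are the invariant that keeps the new kernel
  -- vector independent of the old ones in the inductive step.
  record Split {j} (bs : Vec (El n) j) : Set where
    field
      {rank nullity} : ℕ
      rank+nullity : rank + nullity ≡ j
      preimages : Vec (El n) rank
      kernel : Vec (El n) nullity
      image-independent : LinIndep (Vec.map T preimages)
      kernel-independent : LinIndep kernel
      kernel-⊆ : VAll (λ w → T w ≡ zeroE) kernel
      preimages-⊆span : VAll (InSpan bs) preimages
      kernel-⊆span : VAll (InSpan bs) kernel

  rankNullity : ∀ {j} (bs : Vec (El n) j) → LinIndep bs → Split bs
  rankNullity [] _ = record
    { rank+nullity = refl ; preimages = [] ; kernel = []
    ; image-independent = λ { [] c≢0 _ → c≢0 refl }
    ; kernel-independent = λ { [] c≢0 _ → c≢0 refl }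
    ; kernel-⊆ = [] ; preimages-⊆span = [] ; kernel-⊆span = [] }
  rankNullity (b ∷ bs) ind with rankNullity bs (LinIndep-tail ind)
  ... | S with InSpan? (Vec.map T (Split.preimages S)) (T b)
  ...   | no Tb∉ = record
          { rank+nullity = cong suc rank+nullity
          ; preimages = b ∷ preimages ; kernel = kernel
          ; image-independent = LinIndep-∷ image-independent Tb∉
          ; kernel-independent = kernel-independent
          ; kernel-⊆ = kernel-⊆
          ; preimages-⊆span = InSpan-head bs ∷ VAll.map InSpan-∷ preimages-⊆span
          ; kernel-⊆span = VAll.map InSpan-∷ kernel-⊆span }
          where open Split S
  ...   | yes (spanned c Tas≡Tb) = record
          { rank+nullity = trans (+-suc rank nullity) (cong suc rank+nullity)
          ; preimages = preimages ; kernel = w ∷ kernel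
          ; image-independent = image-independent
          ; kernel-independent = LinIndep-∷ kernel-independent w∉
          ; kernel-⊆ = Tw≡0 ∷ kernel-⊆
          ; preimages-⊆span = VAll.map InSpan-∷ preimages-⊆span
          ; kernel-⊆span = w∈ ∷ VAll.map InSpan-∷ kernel-⊆span }
          where
          open Split S
          w = b ⊕ comb preimages c
          Tw≡0 : T w ≡ zeroE
          Tw≡0 = trans (T-⊕ b _) (trans (cong (T b ⊕_) (trans (T-comb preimages c) Tas≡Tb)) (⊕-same (T b)))
          w∈ : InSpan (b ∷ bs) w
          w∈ = InSpan-⊕ (InSpan-head bs) (InSpan-∷ (InSpan-comb preimages-⊆span c))
          w∉ : ¬ InSpan kernel w
          w∉ (spanned d eq) = LinIndep⇒∉span ind
            (subst (InSpan bs) (trans (cong (_⊕ comb preimages c) eq) (⊕-cancelʳ b _))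
              (InSpan-⊕ (InSpan-comb kernel-⊆span d) (InSpan-comb preimages-⊆span c)))

-- Polynomials over F₂ as coefficient lists

infix 4 _≈ₚ_
_≈ₚ_ : List Bool → List Bool → Set
q ≈ₚ r = ∀ i → coeff q i ≡ coeff r i

Xpow : ℕ → List Bool
Xpow m = List.replicate m false ++ true ∷ []

coeff-Xpow : ∀ m i → coeff (Xpow m) i ≡ (i ≡ᵇ m)
coeff-Xpow zero zero = refl
coeff-Xpow zero (suc i) = refl
coeff-Xpow (suc m) zero = refl
coeff-Xpow (suc m) (suc i) = coeff-Xpow m i

coeff-polyAdd : ∀ q r i → coeff (polyAdd q r) i ≡ coeff q i xor coeff r i
coeff-polyAdd [] r i = refl
coeff-polyAdd (a ∷ q) [] zero = sym (xor-identityʳ a)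
coeff-polyAdd (a ∷ q) [] (suc i) = sym (xor-identityʳ _)
coeff-polyAdd (a ∷ q) (b ∷ r) zero = refl
coeff-polyAdd (a ∷ q) (b ∷ r) (suc i) = coeff-polyAdd q r i

Xⁿ+1 : ℕ → List Bool
Xⁿ+1 m = polyAdd (true ∷ []) (Xpow m)

Xⁿ+1≈ : ∀ m i → coeff (Xⁿ+1 m) i ≡ coeffXn-1 m i
Xⁿ+1≈ m i = trans (coeff-polyAdd (true ∷ []) (Xpow m) i) (cong₂ _xor_ (coeff-one i) (coeff-Xpow m i))
  where
  coeff-one : ∀ i → coeff (true ∷ []) i ≡ (i ≡ᵇ 0)
  coeff-one zero = refl
  coeff-one (suc i) = refl

coeff-if : ∀ a q i → coeff (if a then q else []) i ≡ a ∧ coeff q i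
coeff-if true q i = refl
coeff-if false q i = refl

coeff-polyMul-zero : ∀ g h → coeff (polyMul g h) 0 ≡ coeff g 0 ∧ coeff h 0
coeff-polyMul-zero [] h = refl
coeff-polyMul-zero (a ∷ g) h =
  trans (coeff-polyAdd (if a then h else []) (false ∷ polyMul g h) 0) (trans (xor-identityʳ _) (coeff-if a h 0))

polyMul-congʳ : ∀ g {h h'} → h ≈ₚ h' → polyMul g h ≈ₚ polyMul g h'
polyMul-congʳ [] h≈h' i = refl
polyMul-congʳ (a ∷ g) {h} {h'} h≈h' i = begin
  coeff (polyAdd (if a then h else []) (false ∷ polyMul g h)) i
    ≡⟨ coeff-polyAdd (if a then h else []) _ i ⟩
  coeff (if a then h else []) i xor coeff (false ∷ polyMul g h) i
    ≡⟨ cong₂ _xor_ (trans (coeff-if a h i) (trans (cong (a ∧_) (h≈h' i)) (sym (coeff-if a h' i)))) (shifted i) ⟩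
  coeff (if a then h' else []) i xor coeff (false ∷ polyMul g h') i
    ≡⟨ sym (coeff-polyAdd (if a then h' else []) _ i) ⟩
  coeff (polyAdd (if a then h' else []) (false ∷ polyMul g h')) i ∎
  where
  open ≡-Reasoning
  shifted : false ∷ polyMul g h ≈ₚ false ∷ polyMul g h'
  shifted zero = refl
  shifted (suc i) = polyMul-congʳ g h≈h' i

coeff-beyond : ∀ q i → length q ≤ i → coeff q i ≡ false
coeff-beyond [] i _ = refl
coeff-beyond (a ∷ q) (suc i) (s≤s le) = coeff-beyond q i le

coeff-monic-top : ∀ {m} (c : Vec Bool m) → coeff (monic c) m ≡ true
coeff-monic-top [] = refl
coeff-monic-top (a ∷ c) = coeff-monic-top c

length-monic : ∀ {m} (c : Vec Bool m) → length (monic c) ≡ suc m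
length-monic [] = refl
length-monic (a ∷ c) = cong suc (length-monic c)

coeff-monic·monic-top : ∀ {k m} (c : Vec Bool k) (c' : Vec Bool m) →
  coeff (polyMul (monic c) (monic c')) (k + m) ≡ true
coeff-monic·monic-top {m = m} [] c' =
  trans (coeff-polyAdd (monic c') (false ∷ []) m) (cong₂ _xor_ (coeff-monic-top c') (coeff-false m))
  where
  coeff-false : ∀ i → coeff (false ∷ []) i ≡ false
  coeff-false zero = refl
  coeff-false (suc i) = refl
coeff-monic·monic-top {suc k} {m} (a ∷ c) c' = begin
  coeff (polyAdd (if a then monic c' else []) (false ∷ polyMul (monic c) (monic c'))) (suc (k + m))
    ≡⟨ coeff-polyAdd (if a then monic c' else []) _ (suc (k + m)) ⟩
  coeff (if a then monic c' else []) (suc (k + m)) xor coeff (polyMul (monic c) (monic c')) (k + m)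
    ≡⟨ cong₂ _xor_ (trans (coeff-if a (monic c') _) (trans (cong (a ∧_) c'-vanishes) (∧-zeroʳ a)))
                   (coeff-monic·monic-top c c') ⟩
  true ∎
  where
  open ≡-Reasoning
  c'-vanishes : coeff (monic c') (suc (k + m)) ≡ false
  c'-vanishes = coeff-beyond (monic c') _ (subst (_≤ suc (k + m)) (sym (length-monic c')) (s≤s (m≤n+m m k)))

zero⊎monic : ∀ h → h ≈ₚ [] ⊎ ∃₂ λ m (c : Vec Bool m) → monic c ≈ₚ h
zero⊎monic [] = inj₁ (λ _ → refl)
zero⊎monic (a ∷ h) with zero⊎monic h
... | inj₂ (m , c , c≈h) = inj₂ (suc m , a ∷ c , λ { zero → refl ; (suc i) → c≈h i })
zero⊎monic (false ∷ h) | inj₁ h≈0 = inj₁ λ { zero → refl ; (suc i) → h≈0 i }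
zero⊎monic (true ∷ h) | inj₁ h≈0 = inj₂ (0 , [] , λ { zero → refl ; (suc i) → sym (h≈0 i) })

module _ {n k : ℕ} (1≤n : 1 ≤ n) (1≤k : 1 ≤ k) (c : Vec Bool k) (h : List Bool)
         (gh≈ : ∀ i → coeff (polyMul (monic c) h) i ≡ coeffXn-1 n i) where

  constant-term : coeff (monic c) 0 ∧ coeff h 0 ≡ true
  constant-term = trans (sym (coeff-polyMul-zero (monic c) h)) (trans (gh≈ 0) (lemma 1≤n))
    where
    lemma : ∀ {n} → 1 ≤ n → coeffXn-1 n 0 ≡ true
    lemma (s≤s _) = refl

  cofactor-monic : ∃₂ λ m (c' : Vec Bool m) → monic c' ≈ₚ h × k + m ≡ n
  cofactor-monic with zero⊎monic h
  ... | inj₁ h≈0 = case (begin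
    false                                ≡⟨ sym (∧-zeroʳ _) ⟩
    coeff (monic c) 0 ∧ false            ≡⟨ cong (coeff (monic c) 0 ∧_) (sym (h≈0 0)) ⟩
    coeff (monic c) 0 ∧ coeff h 0        ≡⟨ constant-term ⟩
    true                                 ∎) of λ ()
    where open ≡-Reasoning
  ... | inj₂ (m , c' , c'≈h) = m , c' , c'≈h , k+m≡n
    where
    top : coeffXn-1 n (k + m) ≡ true
    top = trans (sym (gh≈ (k + m))) (trans (sym (polyMul-congʳ (monic c) c'≈h (k + m))) (coeff-monic·monic-top c c'))
    k+m≡n : k + m ≡ n
    k+m≡n = top-degree (k + m) (≤-trans 1≤k (m≤m+n k m)) top
      where
      top-degree : ∀ j → 1 ≤ j → coeffXn-1 n j ≡ true → j ≡ n
      top-degree (suc j) _ e = ≡ᵇ⇒≡ (suc j) n (subst T (sym e) tt)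

-- Multiplication by X modulo p

shift : ∀ {n} → El n → El n
shift x = proj₁ (shiftAux false x)

overflow : ∀ {n} → El n → Bool
overflow x = proj₂ (shiftAux false x)

shiftAux-⊕ : ∀ {n} c d (x y : El n) → shiftAux (c xor d) (x ⊕ y) ≡
  (proj₁ (shiftAux c x) ⊕ proj₁ (shiftAux d y) , proj₂ (shiftAux c x) xor proj₂ (shiftAux d y))
shiftAux-⊕ c d [] [] = refl
shiftAux-⊕ c d (a ∷ x) (b ∷ y) rewrite shiftAux-⊕ a b x y = refl

shiftAux-zeroE : ∀ m → shiftAux false (zeroE {m}) ≡ (zeroE , false)
shiftAux-zeroE zero = refl
shiftAux-zeroE (suc m) rewrite shiftAux-zeroE m = refl

shiftAux-unitVec : ∀ {m} i → suc i < m → shiftAux false (unitVec m i) ≡ (unitVec m (suc i) , false)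
shiftAux-unitVec {suc (suc m)} zero _ rewrite shiftAux-zeroE m = refl
shiftAux-unitVec {suc m} (suc i) (s≤s i<m) rewrite shiftAux-unitVec i i<m = refl

oneE≡unitVec : ∀ {m} → oneE {m} ≡ unitVec m 0
oneE≡unitVec {zero} = refl
oneE≡unitVec {suc m} = cong (true ∷_) (tabulate-false m)
  where
  tabulate-false : ∀ m → tabulate {n = m} (λ _ → false) ≡ zeroE
  tabulate-false zero = refl
  tabulate-false (suc m) = cong (false ∷_) (tabulate-false m)

module QuotientRing {n : ℕ} (p : El n) where

  α : El n → El n
  α = mulα p

  α-⊕ : ∀ x y → α (x ⊕ y) ≡ α x ⊕ α y
  α-⊕ x y = begin
    shift (x ⊕ y) ⊕ scale (overflow (x ⊕ y)) p
      ≡⟨ cong (λ s → proj₁ s ⊕ scale (proj₂ s) p) (shiftAux-⊕ false false x y) ⟩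
    (shift x ⊕ shift y) ⊕ scale (overflow x xor overflow y) p
      ≡⟨ cong ((shift x ⊕ shift y) ⊕_) (scale-xor (overflow x) (overflow y) p) ⟩
    (shift x ⊕ shift y) ⊕ (scale (overflow x) p ⊕ scale (overflow y) p)
      ≡⟨ ⊕-interchange _ _ _ _ ⟩
    α x ⊕ α y ∎
    where open ≡-Reasoning

  open AdditiveMap α α-⊕ using () renaming (T-zeroE to α-zeroE; T-scale to α-scale)

  mulAux-⊕ˡ : ∀ {m} x x' (y : Vec Bool m) → mulAux p (x ⊕ x') y ≡ mulAux p x y ⊕ mulAux p x' y
  mulAux-⊕ˡ x x' [] = sym (⊕-identityʳ zeroE)
  mulAux-⊕ˡ x x' (b ∷ y) = begin
    scale b (x ⊕ x') ⊕ mulAux p (α (x ⊕ x')) y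
      ≡⟨ cong₂ _⊕_ (scale-distrib-⊕ b x x') (cong (λ t → mulAux p t y) (α-⊕ x x')) ⟩
    (scale b x ⊕ scale b x') ⊕ mulAux p (α x ⊕ α x') y
      ≡⟨ cong ((scale b x ⊕ scale b x') ⊕_) (mulAux-⊕ˡ (α x) (α x') y) ⟩
    (scale b x ⊕ scale b x') ⊕ (mulAux p (α x) y ⊕ mulAux p (α x') y)
      ≡⟨ ⊕-interchange _ _ _ _ ⟩
    mulAux p x (b ∷ y) ⊕ mulAux p x' (b ∷ y) ∎
    where open ≡-Reasoning

  module _ {m} (y : Vec Bool m) where
    open AdditiveMap (λ x → mulAux p x y) (λ x x' → mulAux-⊕ˡ x x' y) public
      using () renaming (T-zeroE to mulAux-zeroˡ; T-scale to mulAux-scaleˡ)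

  α-mulAux : ∀ {m} x (y : Vec Bool m) → α (mulAux p x y) ≡ mulAux p (α x) y
  α-mulAux x [] = α-zeroE
  α-mulAux x (b ∷ y) = begin
    α (scale b x ⊕ mulAux p (α x) y)        ≡⟨ α-⊕ (scale b x) (mulAux p (α x) y) ⟩
    α (scale b x) ⊕ α (mulAux p (α x) y)    ≡⟨ cong₂ _⊕_ (α-scale b x) (α-mulAux (α x) y) ⟩
    scale b (α x) ⊕ mulAux p (α (α x)) y    ∎
    where open ≡-Reasoning

  mulAux-swap : ∀ {m m'} x (y : Vec Bool m) (z : Vec Bool m') →
    mulAux p (mulAux p x z) y ≡ mulAux p (mulAux p x y) z
  mulAux-swap x y [] = mulAux-zeroˡ y
  mulAux-swap x y (b ∷ z) = begin
    mulAux p (scale b x ⊕ mulAux p (α x) z) y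
      ≡⟨ mulAux-⊕ˡ _ _ y ⟩
    mulAux p (scale b x) y ⊕ mulAux p (mulAux p (α x) z) y
      ≡⟨ cong₂ _⊕_ (mulAux-scaleˡ y b x) (mulAux-swap (α x) y z) ⟩
    scale b (mulAux p x y) ⊕ mulAux p (mulAux p (α x) y) z
      ≡⟨ cong (λ t → scale b (mulAux p x y) ⊕ mulAux p t z) (sym (α-mulAux x y)) ⟩
    scale b (mulAux p x y) ⊕ mulAux p (α (mulAux p x y)) z ∎
    where open ≡-Reasoning

  α-unitVec : ∀ i → suc i < n → α (unitVec n i) ≡ unitVec n (suc i)
  α-unitVec i i+1<n rewrite shiftAux-unitVec i i+1<n = ⊕-identityʳ (unitVec n (suc i))

  mulAux-unitVec : ∀ {j} i (bs : Vec Bool j) → i + j ≤ n → mulAux p (unitVec n i) bs ≡ comb (unitVecs j i) bs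
  mulAux-unitVec i [] _ = refl
  mulAux-unitVec i (b ∷ []) _ = refl
  mulAux-unitVec {suc (suc j)} i (b ∷ bs@(_ ∷ _)) i+j+2≤n = cong (scale b (unitVec n i) ⊕_) (begin
    mulAux p (α (unitVec n i)) bs     ≡⟨ cong (λ t → mulAux p t bs) (α-unitVec i i+1<n) ⟩
    mulAux p (unitVec n (suc i)) bs   ≡⟨ mulAux-unitVec (suc i) bs i+1+j+1≤n ⟩
    comb (unitVecs _ (suc i)) bs      ∎)
    where
    open ≡-Reasoning
    i+1+j+1≤n : suc i + suc j ≤ n
    i+1+j+1≤n = subst (_≤ n) (+-suc i (suc j)) i+j+2≤n
    i+1<n : suc i < n
    i+1<n = ≤-trans (s≤s (s≤s (m≤m+n i j))) (subst (_≤ n) (cong suc (+-suc i j)) i+1+j+1≤n)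

  infixl 25 _·_
  _·_ : El n → El n → El n
  x · y = mulE p x y

  ·-identityˡ : ∀ y → oneE · y ≡ y
  ·-identityˡ y = begin
    mulAux p oneE y          ≡⟨ cong (λ t → mulAux p t y) oneE≡unitVec ⟩
    mulAux p (unitVec n 0) y ≡⟨ mulAux-unitVec 0 y ≤-refl ⟩
    comb (standardBasis n) y ≡⟨ comb-standardBasis y ⟩
    y                        ∎
    where open ≡-Reasoning

  ·-comm : ∀ x y → x · y ≡ y · x
  ·-comm x y = begin
    mulAux p x y                 ≡⟨ cong (λ t → mulAux p t y) (sym (·-identityˡ x)) ⟩
    mulAux p (mulAux p oneE x) y ≡⟨ mulAux-swap oneE y x ⟩
    mulAux p (mulAux p oneE y) x ≡⟨ cong (λ t → mulAux p t x) (·-identityˡ y) ⟩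
    mulAux p y x                 ∎
    where open ≡-Reasoning

  ·-zeroˡ : ∀ x → zeroE · x ≡ zeroE
  ·-zeroˡ = mulAux-zeroˡ

  ·-zeroʳ : ∀ x → x · zeroE ≡ zeroE
  ·-zeroʳ x = trans (·-comm x zeroE) (·-zeroˡ x)

  ·-identityʳ : ∀ x → x · oneE ≡ x
  ·-identityʳ x = trans (·-comm x oneE) (·-identityˡ x)

  ·-assoc : ∀ x y z → (x · y) · z ≡ x · (y · z)
  ·-assoc x y z = begin
    mulAux p (mulAux p x y) z ≡⟨ cong (λ t → mulAux p t z) (·-comm x y) ⟩
    mulAux p (mulAux p y x) z ≡⟨ sym (mulAux-swap y x z) ⟩
    mulAux p (mulAux p y z) x ≡⟨ ·-comm (y · z) x ⟩
    mulAux p x (mulAux p y z) ∎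
    where open ≡-Reasoning

  ·-isCommutativeMonoid : IsCommutativeMonoid _≡_ _·_ oneE
  ·-isCommutativeMonoid = record
    { isMonoid = record
      { isSemigroup = record { isMagma = isMagma _·_ ; assoc = ·-assoc }
      ; identity = ·-identityˡ , ·-identityʳ
      }
    ; comm = ·-comm
    }

  commutativeSemiring : CommutativeSemiring 0ℓ 0ℓ
  commutativeSemiring = record
    { isCommutativeSemiring = isCommutativeSemiringˡ record
      { +-isCommutativeMonoid = ⊕-isCommutativeMonoid
      ; *-isCommutativeMonoid = ·-isCommutativeMonoid
      ; distribʳ = λ z x y → mulAux-⊕ˡ x y z
      ; zeroˡ = ·-zeroˡ
      }
    }

  -- Expressions with coefficients in F₂ = Bool are normalised by the ring
  -- solver, so identities valid in characteristic 2 are decided too.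
  private
    ⟦_⟧ : Bool → El n
    ⟦ b ⟧ = scale b oneE

    F₂⟶El : CommutativeRing.rawRing xor-∧-commutativeRing
            -Raw-AlmostCommutative⟶ fromCommutativeSemiring commutativeSemiring
    F₂⟶El = record
      { ⟦_⟧ = ⟦_⟧
      ; +-homo = λ a b → scale-xor a b oneE
      ; *-homo = λ { true b → sym (·-identityˡ ⟦ b ⟧) ; false b → sym (mulAux-zeroˡ ⟦ b ⟧) }
      ; -‿homo = λ _ → refl
      ; 0-homo = refl
      ; 1-homo = refl
      }

    _≟F₂_ : ∀ a b → Maybe (⟦ a ⟧ ≡ ⟦ b ⟧)
    true ≟F₂ true = just refl
    false ≟F₂ false = just refl
    _ ≟F₂ _ = nothing

  module Solver = RingSolver _ _ F₂⟶El _≟F₂_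

module Frobenius {n : ℕ} (p : El n) where
  open QuotientRing p
  open Solver using (solve; _:=_; _:+_; _:*_)

  σ : El n → El n
  σ x = x · x

  σ-⊕ : ∀ x y → σ (x ⊕ y) ≡ σ x ⊕ σ y
  σ-⊕ = solve 2 (λ x y → (x :+ y) :* (x :+ y) := x :* x :+ y :* y) refl

  σ-· : ∀ x y → σ (x · y) ≡ σ x · σ y
  σ-· = solve 2 (λ x y → (x :* y) :* (x :* y) := (x :* x) :* (y :* y)) refl

  open AdditiveMap σ σ-⊕ using () renaming (T-zeroE to σ-zeroE; T-scale to σ-scale)

  σ^ : ℕ → El n → El n
  σ^ zero x = x
  σ^ (suc j) x = σ (σ^ j x)

  σ^-σ : ∀ j x → σ^ j (σ x) ≡ σ (σ^ j x)
  σ^-σ zero x = refl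
  σ^-σ (suc j) x = cong σ (σ^-σ j x)

  powE-+ : ∀ x a b → powE p x (a + b) ≡ powE p x a · powE p x b
  powE-+ x zero b = sym (·-identityˡ _)
  powE-+ x (suc a) b = trans (cong (x ·_) (powE-+ x a b)) (sym (·-assoc x (powE p x a) (powE p x b)))

  σ^≡powE : ∀ j x → σ^ j x ≡ powE p x (2 ^ j)
  σ^≡powE zero x = sym (·-identityʳ x)
  σ^≡powE (suc j) x = begin
    σ (σ^ j x)                                ≡⟨ cong σ (σ^≡powE j x) ⟩
    powE p x (2 ^ j) · powE p x (2 ^ j)       ≡⟨ sym (powE-+ x (2 ^ j) (2 ^ j)) ⟩
    powE p x (2 ^ j + 2 ^ j)                  ≡⟨ cong (λ t → powE p x (2 ^ j + t)) (sym (+-identityʳ (2 ^ j))) ⟩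
    powE p x (2 ^ suc j)                      ∎
    where open ≡-Reasoning

  -- The linearised polynomial of q = Σ qᵢ Xⁱ is x ↦ Σ qᵢ x^(2^i).
  lin : List Bool → El n → El n
  lin [] x = zeroE
  lin (a ∷ q) x = scale a x ⊕ lin q (σ x)

  lin-⊕ : ∀ q x y → lin q (x ⊕ y) ≡ lin q x ⊕ lin q y
  lin-⊕ [] x y = sym (⊕-identityʳ zeroE)
  lin-⊕ (a ∷ q) x y = begin
    scale a (x ⊕ y) ⊕ lin q (σ (x ⊕ y))
      ≡⟨ cong₂ _⊕_ (scale-distrib-⊕ a x y) (trans (cong (lin q) (σ-⊕ x y)) (lin-⊕ q (σ x) (σ y))) ⟩
    (scale a x ⊕ scale a y) ⊕ (lin q (σ x) ⊕ lin q (σ y))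
      ≡⟨ ⊕-interchange _ _ _ _ ⟩
    lin (a ∷ q) x ⊕ lin (a ∷ q) y ∎
    where open ≡-Reasoning

  module _ (q : List Bool) where
    open AdditiveMap (lin q) (lin-⊕ q) public
      using () renaming (T-comb-kernel to lin-comb-kernel)

  lin-σ : ∀ q x → σ (lin q x) ≡ lin q (σ x)
  lin-σ [] x = σ-zeroE
  lin-σ (a ∷ q) x = trans (σ-⊕ (scale a x) (lin q (σ x))) (cong₂ _⊕_ (σ-scale a x) (lin-σ q (σ x)))

  lin-polyAdd : ∀ q r x → lin (polyAdd q r) x ≡ lin q x ⊕ lin r x
  lin-polyAdd [] r x = sym (⊕-identityˡ _)
  lin-polyAdd (a ∷ q) [] x = sym (⊕-identityʳ _)
  lin-polyAdd (a ∷ q) (b ∷ r) x = begin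
    scale (a xor b) x ⊕ lin (polyAdd q r) (σ x)
      ≡⟨ cong₂ _⊕_ (scale-xor a b x) (lin-polyAdd q r (σ x)) ⟩
    (scale a x ⊕ scale b x) ⊕ (lin q (σ x) ⊕ lin r (σ x))
      ≡⟨ ⊕-interchange _ _ _ _ ⟩
    lin (a ∷ q) x ⊕ lin (b ∷ r) x ∎
    where open ≡-Reasoning

  lin-polyMul : ∀ q r x → lin (polyMul q r) x ≡ lin q (lin r x)
  lin-polyMul [] r x = refl
  lin-polyMul (a ∷ q) r x = begin
    lin (polyAdd (if a then r else []) (false ∷ polyMul q r)) x
      ≡⟨ lin-polyAdd (if a then r else []) _ x ⟩
    lin (if a then r else []) x ⊕ (zeroE ⊕ lin (polyMul q r) (σ x))
      ≡⟨ cong₂ _⊕_ (lin-if a) (trans (⊕-identityˡ _) (lin-polyMul q r (σ x))) ⟩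
    scale a (lin r x) ⊕ lin q (lin r (σ x))
      ≡⟨ cong (λ t → scale a (lin r x) ⊕ lin q t) (sym (lin-σ r x)) ⟩
    lin (a ∷ q) (lin r x) ∎
    where
    open ≡-Reasoning
    lin-if : ∀ a → lin (if a then r else []) x ≡ scale a (lin r x)
    lin-if true = refl
    lin-if false = refl

  lin-vanishes : ∀ q → q ≈ₚ [] → ∀ x → lin q x ≡ zeroE
  lin-vanishes [] _ x = refl
  lin-vanishes (a ∷ q) q≈0 x = begin
    scale a x ⊕ lin q (σ x)
      ≡⟨ cong₂ (λ b t → scale b x ⊕ t) (q≈0 0) (lin-vanishes q (q≈0 ∘ suc) (σ x)) ⟩
    zeroE ⊕ zeroE           ≡⟨ ⊕-same zeroE ⟩
    zeroE                   ∎
    where open ≡-Reasoning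

  lin-cong : ∀ q r → q ≈ₚ r → ∀ x → lin q x ≡ lin r x
  lin-cong q [] q≈r x = lin-vanishes q q≈r x
  lin-cong [] r q≈r x = sym (lin-vanishes r (sym ∘ q≈r) x)
  lin-cong (a ∷ q) (b ∷ r) q≈r x = cong₂ (λ b t → scale b x ⊕ t) (q≈r 0) (lin-cong q r (q≈r ∘ suc) (σ x))

  lin-Xpow : ∀ m x → lin (Xpow m) x ≡ σ^ m x
  lin-Xpow zero x = ⊕-identityʳ x
  lin-Xpow (suc m) x = trans (⊕-identityˡ _) (trans (lin-Xpow m (σ x)) (σ^-σ m x))

  -- By Q-·σ, Q r e · e² = lin r (e⁴); on the kernel of lin (1 + X² r), where
  -- e = lin r (e⁴), Q r is therefore the inverse map, and it is visibly a sum
  -- of products of Frobenius images of e.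
  Q : List Bool → El n → El n
  Q [] e = zeroE
  Q (a ∷ r) e = scale a (σ e) ⊕ σ (e · Q r e)

  Q-·σ : ∀ r e → Q r e · σ e ≡ lin r (σ (σ e))
  Q-·σ [] e = ·-zeroˡ (σ e)
  Q-·σ (a ∷ r) e = begin
    (scale a (σ e) ⊕ σ (e · Q r e)) · σ e
      ≡⟨ mulAux-⊕ˡ (scale a (σ e)) _ (σ e) ⟩
    scale a (σ e) · σ e ⊕ σ (e · Q r e) · σ e
      ≡⟨ cong₂ _⊕_ (mulAux-scaleˡ (σ e) a (σ e)) (sym (σ-· (e · Q r e) e)) ⟩
    scale a (σ (σ e)) ⊕ σ (e · Q r e · e)
      ≡⟨ cong (λ t → scale a (σ (σ e)) ⊕ σ t) (reassoc e (Q r e)) ⟩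
    scale a (σ (σ e)) ⊕ σ (Q r e · σ e)
      ≡⟨ cong (λ t → scale a (σ (σ e)) ⊕ σ t) (Q-·σ r e) ⟩
    scale a (σ (σ e)) ⊕ σ (lin r (σ (σ e)))
      ≡⟨ cong (scale a (σ (σ e)) ⊕_) (lin-σ r (σ (σ e))) ⟩
    lin (a ∷ r) (σ (σ e)) ∎
    where
    open ≡-Reasoning
    reassoc : ∀ e q → e · q · e ≡ q · σ e
    reassoc = solve 2 (λ e q → e :* q :* e := q :* (e :* e)) refl

  Q-zeroE : ∀ r → Q r zeroE ≡ zeroE
  Q-zeroE [] = refl
  Q-zeroE (a ∷ r) = begin
    scale a (σ zeroE) ⊕ σ (zeroE · Q r zeroE)
      ≡⟨ cong₂ (λ s t → scale a s ⊕ σ t) σ-zeroE (·-zeroˡ (Q r zeroE)) ⟩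
    scale a zeroE ⊕ σ zeroE
      ≡⟨ cong₂ _⊕_ (scale-zeroE a) σ-zeroE ⟩
    zeroE ⊕ zeroE
      ≡⟨ ⊕-same zeroE ⟩
    zeroE ∎
    where open ≡-Reasoning

sumE-++ : ∀ {n} (xs ys : List (El n)) → sumE (xs ++ ys) ≡ sumE xs ⊕ sumE ys
sumE-++ [] ys = sym (⊕-identityˡ _)
sumE-++ (x ∷ xs) ys = trans (cong (x ⊕_) (sumE-++ xs ys)) (sym (⊕-assoc x (sumE xs) (sumE ys)))

-- Algebraic degree of functions F₂ᵏ → El n, defined recursively: deg f ≤ d
-- iff f restricted to c₀ = 0 has degree ≤ d and the derivative Δ f in the
-- first coordinate has degree < d, where degree < 0 means f = 0.
module AlgebraicDegree {n : ℕ} (p : El n) where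
  open QuotientRing p
  open Frobenius p
  open Solver using (solve; _:=_; _:+_; _:*_)

  Fn : ℕ → Set
  Fn k = Vec Bool k → El n

  Δ : ∀ {k} → Fn (suc k) → Fn k
  Δ f c = f (true ∷ c) ⊕ f (false ∷ c)

  ∑ : ∀ {k} → Fn k → El n
  ∑ {k} f = sumE (map f (allVecs k))

  data Degree≤ : (k d : ℕ) → Fn k → Set
  data Degree< : (k d : ℕ) → Fn k → Set

  data Degree≤ where
    dim-zero : ∀ {d f} → Degree≤ zero d f
    split : ∀ {k d f} → Degree≤ k d (f ∘ (false ∷_)) → Degree< k d (Δ f) → Degree≤ (suc k) d f

  data Degree< where
    vanishing : ∀ {k g} → (∀ c → g c ≡ zeroE) → Degree< k zero g
    below : ∀ {k d g} → Degree≤ k d g → Degree< k (suc d) g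

  Degree≤-resp : ∀ {k d} {f g : Fn k} → f ≗ g → Degree≤ k d f → Degree≤ k d g
  Degree<-resp : ∀ {k d} {f g : Fn k} → f ≗ g → Degree< k d f → Degree< k d g
  Degree≤-resp f≗g dim-zero = dim-zero
  Degree≤-resp f≗g (split F₀ FΔ) =
    split (Degree≤-resp (f≗g ∘ (false ∷_)) F₀)
          (Degree<-resp (λ c → cong₂ _⊕_ (f≗g (true ∷ c)) (f≗g (false ∷ c))) FΔ)
  Degree<-resp f≗g (vanishing f≈0) = vanishing (λ c → trans (sym (f≗g c)) (f≈0 c))
  Degree<-resp f≗g (below F) = below (Degree≤-resp f≗g F)

  Degree≤-vanishing : ∀ {k d} {g : Fn k} → (∀ c → g c ≡ zeroE) → Degree≤ k d g
  Degree<-vanishing : ∀ {k d} {g : Fn k} → (∀ c → g c ≡ zeroE) → Degree< k d g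
  Degree≤-vanishing {zero} g≈0 = dim-zero
  Degree≤-vanishing {suc k} g≈0 =
    split (Degree≤-vanishing (g≈0 ∘ (false ∷_)))
          (Degree<-vanishing λ c → trans (cong₂ _⊕_ (g≈0 (true ∷ c)) (g≈0 (false ∷ c))) (⊕-same zeroE))
  Degree<-vanishing {d = zero} g≈0 = vanishing g≈0
  Degree<-vanishing {d = suc d} g≈0 = below (Degree≤-vanishing g≈0)

  Degree≤-suc : ∀ {k d} {f : Fn k} → Degree≤ k d f → Degree≤ k (suc d) f
  Degree<⇒Degree≤ : ∀ {k d} {f : Fn k} → Degree< k d f → Degree≤ k d f
  Degree≤-suc dim-zero = dim-zero
  Degree≤-suc (split F₀ FΔ) = split (Degree≤-suc F₀) (below (Degree<⇒Degree≤ FΔ))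
  Degree<⇒Degree≤ (vanishing f≈0) = Degree≤-vanishing f≈0
  Degree<⇒Degree≤ (below F) = Degree≤-suc F

  Degree≤-mono : ∀ {k d d'} {f : Fn k} → d ≤ d' → Degree≤ k d f → Degree≤ k d' f
  Degree≤-mono d≤d' = go (≤⇒≤′ d≤d')
    where
    go : ∀ {k d d'} {f : Fn k} → d ≤′ d' → Degree≤ k d f → Degree≤ k d' f
    go ≤′-refl F = F
    go (≤′-step d≤d') F = Degree≤-suc (go d≤d' F)

  Degree≤-const : ∀ {k d} a → Degree≤ k d (λ _ → a)
  Degree≤-const {zero} a = dim-zero
  Degree≤-const {suc k} a = split (Degree≤-const a) (Degree<-vanishing (λ _ → ⊕-same a))

  Degree≤-⊕ : ∀ {k d} {f g : Fn k} → Degree≤ k d f → Degree≤ k d g → Degree≤ k d (λ c → f c ⊕ g c)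
  Degree<-⊕ : ∀ {k d} {f g : Fn k} → Degree< k d f → Degree< k d g → Degree< k d (λ c → f c ⊕ g c)
  Degree≤-⊕ dim-zero dim-zero = dim-zero
  Degree≤-⊕ {f = f} {g} (split F₀ FΔ) (split G₀ GΔ) =
    split (Degree≤-⊕ F₀ G₀) (Degree<-resp (λ c → ⊕-interchange (f (true ∷ c)) _ _ _) (Degree<-⊕ FΔ GΔ))
  Degree<-⊕ (vanishing f≈0) (vanishing g≈0) =
    vanishing (λ c → trans (cong₂ _⊕_ (f≈0 c) (g≈0 c)) (⊕-same zeroE))
  Degree<-⊕ (below F) (below G) = below (Degree≤-⊕ F G)

  module _ (T : El n → El n) (T-⊕ : ∀ x y → T (x ⊕ y) ≡ T x ⊕ T y) where
    open AdditiveMap T T-⊕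

    Degree≤-additive : ∀ {k d} {f : Fn k} → Degree≤ k d f → Degree≤ k d (T ∘ f)
    Degree<-additive : ∀ {k d} {f : Fn k} → Degree< k d f → Degree< k d (T ∘ f)
    Degree≤-additive dim-zero = dim-zero
    Degree≤-additive {f = f} (split F₀ FΔ) =
      split (Degree≤-additive F₀)
            (Degree<-resp (λ c → T-⊕ (f (true ∷ c)) (f (false ∷ c))) (Degree<-additive FΔ))
    Degree<-additive (vanishing f≈0) = vanishing (λ c → trans (cong T (f≈0 c)) T-zeroE)
    Degree<-additive (below F) = below (Degree≤-additive F)

  Degree≤-comb : ∀ {k} (vs : Vec (El n) k) → Degree≤ k 1 (comb vs)
  Degree≤-comb [] = dim-zero
  Degree≤-comb (v ∷ vs) =
    split (Degree≤-resp (λ c → sym (⊕-identityˡ (comb vs c))) (Degree≤-comb vs))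
          (below (Degree≤-resp Δcomb≡v (Degree≤-const v)))
    where
    Δcomb≡v : ∀ c → v ≡ (v ⊕ comb vs c) ⊕ (zeroE ⊕ comb vs c)
    Δcomb≡v c = sym (trans (cong ((v ⊕ comb vs c) ⊕_) (⊕-identityˡ (comb vs c))) (⊕-cancelʳ v (comb vs c)))

  Degree≤-· : ∀ {k a b} {f g : Fn k} →
    Degree≤ k a f → Degree≤ k b g → Degree≤ k (a + b) (λ c → f c · g c)
  Degree<-·≤ : ∀ {k a b} {f g : Fn k} →
    Degree< k a f → Degree≤ k b g → Degree< k (a + b) (λ c → f c · g c)
  Degree≤-·< : ∀ {k a b} {f g : Fn k} →
    Degree≤ k a f → Degree< k b g → Degree< k (a + b) (λ c → f c · g c)
  Degree≤-· dim-zero _ = dim-zero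
  Degree≤-· {f = f} {g} (split F₀ FΔ) (split G₀ GΔ) =
    split (Degree≤-· F₀ G₀)
          (Degree<-resp (sym ∘ product-rule) (Degree<-⊕ (Degree<-·≤ FΔ G₁) (Degree≤-·< F₀ GΔ)))
    where
    G₁ : Degree≤ _ _ (g ∘ (true ∷_))
    G₁ = Degree≤-resp (λ c → trans (⊕-comm (g (false ∷ c)) _) (⊕-cancelʳ (g (true ∷ c)) (g (false ∷ c))))
                      (Degree≤-⊕ G₀ (Degree<⇒Degree≤ GΔ))
    product-rule : ∀ c → Δ (λ c → f c · g c) c ≡ Δ f c · g (true ∷ c) ⊕ f (false ∷ c) · Δ g c
    product-rule c = solve 4 (λ f₁ f₀ g₁ g₀ →
      f₁ :* g₁ :+ f₀ :* g₀ := (f₁ :+ f₀) :* g₁ :+ f₀ :* (g₁ :+ g₀)) refl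
      (f (true ∷ c)) (f (false ∷ c)) (g (true ∷ c)) (g (false ∷ c))
  Degree<-·≤ {f = f} {g} (vanishing f≈0) _ =
    Degree<-vanishing (λ c → trans (cong (_· g c) (f≈0 c)) (·-zeroˡ (g c)))
  Degree<-·≤ (below F) G = below (Degree≤-· F G)
  Degree≤-·< {f = f} {g} _ (vanishing g≈0) =
    Degree<-vanishing (λ c → trans (cong (f c ·_) (g≈0 c)) (·-zeroʳ (f c)))
  Degree≤-·< {k} {a} {suc b} {f} {g} F (below G) =
    subst (λ d → Degree< k d (λ c → f c · g c)) (sym (+-suc a b)) (below (Degree≤-· F G))

  ∑-split : ∀ {k} (f : Fn (suc k)) → ∑ f ≡ ∑ (f ∘ (false ∷_)) ⊕ ∑ (f ∘ (true ∷_))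
  ∑-split {k} f = begin
    sumE (map f (map (false ∷_) (allVecs k) ++ map (true ∷_) (allVecs k)))
      ≡⟨ cong sumE (map-++ f (map (false ∷_) (allVecs k)) _) ⟩
    sumE (map f (map (false ∷_) (allVecs k)) ++ map f (map (true ∷_) (allVecs k)))
      ≡⟨ sumE-++ (map f (map (false ∷_) (allVecs k))) _ ⟩
    sumE (map f (map (false ∷_) (allVecs k))) ⊕ sumE (map f (map (true ∷_) (allVecs k)))
      ≡⟨ sym (cong₂ (λ u v → sumE u ⊕ sumE v) (map-∘ (allVecs k)) (map-∘ (allVecs k))) ⟩
    ∑ (f ∘ (false ∷_)) ⊕ ∑ (f ∘ (true ∷_)) ∎
    where open ≡-Reasoning

  ∑-cong : ∀ {k} {f g : Fn k} → f ≗ g → ∑ f ≡ ∑ g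
  ∑-cong {k} f≗g = cong sumE (map-cong f≗g (allVecs k))

  ∑-⊕ : ∀ {k} (f g : Fn k) → ∑ (λ c → f c ⊕ g c) ≡ ∑ f ⊕ ∑ g
  ∑-⊕ {k} f g = go (allVecs k)
    where
    go : ∀ cs → sumE (map (λ c → f c ⊕ g c) cs) ≡ sumE (map f cs) ⊕ sumE (map g cs)
    go [] = sym (⊕-identityʳ zeroE)
    go (c ∷ cs) = trans (cong ((f c ⊕ g c) ⊕_) (go cs)) (⊕-interchange (f c) (g c) _ _)

  -- In characteristic 2, ∑ f is the sum of the derivative Δ f over one
  -- dimension less.
  ∑-vanishes : ∀ {k} {f : Fn k} → Degree< k k f → ∑ f ≡ zeroE
  ∑-vanishes {zero} {f} (vanishing f≈0) = trans (cong (_⊕ zeroE) (f≈0 [])) (⊕-same zeroE)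
  ∑-vanishes {suc k} {f} (below (split _ FΔ)) = begin
    ∑ f                                      ≡⟨ ∑-split f ⟩
    ∑ (f ∘ (false ∷_)) ⊕ ∑ (f ∘ (true ∷_))   ≡⟨ sym (∑-⊕ (f ∘ (false ∷_)) (f ∘ (true ∷_))) ⟩
    ∑ (λ c → f (false ∷ c) ⊕ f (true ∷ c))   ≡⟨ ∑-cong (λ c → ⊕-comm (f (false ∷ c)) _) ⟩
    ∑ (Δ f)                                  ≡⟨ ∑-vanishes FΔ ⟩
    zeroE                                    ∎
    where open ≡-Reasoning

  Degree≤-Q : ∀ {k} {f : Fn k} → Degree≤ k 1 f → ∀ r → Degree≤ k (length r) (Q r ∘ f)
  Degree≤-Q F [] = Degree≤-const zeroE
  Degree≤-Q F (a ∷ r) =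
    Degree≤-⊕ (Degree≤-mono (s≤s z≤n) (Degree≤-scale a (Degree≤-σ F)))
              (Degree≤-σ (Degree≤-· F (Degree≤-Q F r)))
    where
    Degree≤-σ = Degree≤-additive σ σ-⊕
    Degree≤-scale = λ a → Degree≤-additive (scale a) (scale-distrib-⊕ a)

module PolynomialFunctions {n : ℕ} (p : El n) where
  open QuotientRing p
  open Frobenius p
  open Solver using (solve; _:=_; _:+_; _:*_; con)

  data Poly≤ : ℕ → (El n → El n) → Set where
    const : ∀ {f} a → (∀ x → f x ≡ a) → Poly≤ 0 f
    horner : ∀ {d f} a g → Poly≤ d g → (∀ x → f x ≡ a ⊕ x · g x) → Poly≤ (suc d) f

  data Monic : ℕ → (El n → El n) → Set where
    one : ∀ {f} → (∀ x → f x ≡ oneE) → Monic 0 f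
    horner : ∀ {d f} a g → Monic d g → (∀ x → f x ≡ a ⊕ x · g x) → Monic (suc d) f

  Monic-resp : ∀ {d f g} → f ≗ g → Monic d f → Monic d g
  Monic-resp f≗g (one f≡1) = one (λ x → trans (sym (f≗g x)) (f≡1 x))
  Monic-resp f≗g (horner a h H f≡) = horner a h H (λ x → trans (sym (f≗g x)) (f≡ x))

  Monic⇒Poly≤ : ∀ {d f} → Monic d f → Poly≤ d f
  Monic⇒Poly≤ (one f≡1) = const oneE f≡1
  Monic⇒Poly≤ (horner a g G f≡) = horner a g (Monic⇒Poly≤ G) f≡

  private
    a≡a⊕x·0 : ∀ a x → a ≡ a ⊕ x · zeroE
    a≡a⊕x·0 a x = sym (trans (cong (a ⊕_) (·-zeroʳ x)) (⊕-identityʳ a))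

  Poly≤-const : ∀ {d} a → Poly≤ d (λ _ → a)
  Poly≤-const {zero} a = const a (λ _ → refl)
  Poly≤-const {suc d} a = horner a (λ _ → zeroE) (Poly≤-const zeroE) (a≡a⊕x·0 a)

  Poly≤-suc : ∀ {d f} → Poly≤ d f → Poly≤ (suc d) f
  Poly≤-suc (const a f≡a) = horner a (λ _ → zeroE) (Poly≤-const zeroE) (λ x → trans (f≡a x) (a≡a⊕x·0 a x))
  Poly≤-suc (horner a g G f≡) = horner a g (Poly≤-suc G) f≡

  Poly≤-mono : ∀ {d d' f} → d ≤ d' → Poly≤ d f → Poly≤ d' f
  Poly≤-mono d≤d' = go (≤⇒≤′ d≤d')
    where
    go : ∀ {d d' f} → d ≤′ d' → Poly≤ d f → Poly≤ d' f
    go ≤′-refl F = F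
    go (≤′-step d≤d') F = Poly≤-suc (go d≤d' F)

  private
    horner-⊕ : ∀ a b x u v → (a ⊕ x · u) ⊕ (b ⊕ x · v) ≡ (a ⊕ b) ⊕ x · (u ⊕ v)
    horner-⊕ = solve 5 (λ a b x u v → (a :+ x :* u) :+ (b :+ x :* v) := (a :+ b) :+ x :* (u :+ v)) refl

  Poly≤-⊕ : ∀ {d f g} → Poly≤ d f → Poly≤ d g → Poly≤ d (λ x → f x ⊕ g x)
  Poly≤-⊕ (const a f≡a) (const b g≡b) = const (a ⊕ b) (λ x → cong₂ _⊕_ (f≡a x) (g≡b x))
  Poly≤-⊕ (horner a f' F f≡) (horner b g' G g≡) = horner (a ⊕ b) (λ x → f' x ⊕ g' x) (Poly≤-⊕ F G)
    (λ x → trans (cong₂ _⊕_ (f≡ x) (g≡ x)) (horner-⊕ a b x (f' x) (g' x)))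

  Poly≤-scale : ∀ {d f} b → Poly≤ d f → Poly≤ d (λ x → scale b (f x))
  Poly≤-scale true F = F
  Poly≤-scale false F = Poly≤-const zeroE

  Monic-⊕-lower : ∀ {d d' f g} → Monic d f → Poly≤ d' g → d' < d → Monic d (λ x → f x ⊕ g x)
  Monic-⊕-lower (horner a f' F f≡) (const b g≡b) _ = horner (a ⊕ b) f' F (λ x →
    trans (cong₂ _⊕_ (f≡ x) (g≡b x)) (solve 3 (λ a b t → (a :+ t) :+ b := (a :+ b) :+ t) refl a b (x · f' x)))
  Monic-⊕-lower (horner a f' F f≡) (horner b g' G g≡) (s≤s d'<d) = horner (a ⊕ b) (λ x → f' x ⊕ g' x)
    (Monic-⊕-lower F G d'<d) (λ x → trans (cong₂ _⊕_ (f≡ x) (g≡ x)) (horner-⊕ a b x (f' x) (g' x)))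

  Monic-powE : ∀ e → Monic e (λ x → powE p x e)
  Monic-powE zero = one (λ _ → refl)
  Monic-powE (suc e) = horner zeroE (λ x → powE p x e) (Monic-powE e) (λ x → sym (⊕-identityˡ _))

  Monic-σ^ : ∀ j → Monic (2 ^ j) (σ^ j)
  Monic-σ^ j = Monic-resp (sym ∘ σ^≡powE j) (Monic-powE (2 ^ j))

  lin-++ : ∀ q r x → lin (q ++ r) x ≡ lin q x ⊕ lin r (σ^ (length q) x)
  lin-++ [] r x = sym (⊕-identityˡ _)
  lin-++ (a ∷ q) r x = begin
    scale a x ⊕ lin (q ++ r) (σ x)
      ≡⟨ cong (scale a x ⊕_) (lin-++ q r (σ x)) ⟩
    scale a x ⊕ (lin q (σ x) ⊕ lin r (σ^ (length q) (σ x)))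
      ≡⟨ cong (λ t → scale a x ⊕ (lin q (σ x) ⊕ lin r t)) (σ^-σ (length q) x) ⟩
    scale a x ⊕ (lin q (σ x) ⊕ lin r (σ^ (suc (length q)) x))
      ≡⟨ sym (⊕-assoc (scale a x) _ _) ⟩
    lin (a ∷ q) x ⊕ lin r (σ^ (length (a ∷ q)) x) ∎
    where open ≡-Reasoning

  Poly≤-lin∘σ^ : ∀ r j {D} → 2 ^ (j + length r) ≤ suc D → Poly≤ D (λ x → lin r (σ^ j x))
  Poly≤-lin∘σ^ [] j _ = Poly≤-const zeroE
  Poly≤-lin∘σ^ (a ∷ r) j {D} bound = Poly≤-⊕
    (Poly≤-scale a (Poly≤-mono 2^j≤D (Monic⇒Poly≤ (Monic-σ^ j))))
    (Poly≤-lin∘σ^ r (suc j) bound′)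
    where
    bound′ : 2 ^ (suc j + length r) ≤ suc D
    bound′ = subst (λ e → 2 ^ e ≤ suc D) (+-suc j (length r)) bound
    2^j≤D : 2 ^ j ≤ D
    2^j≤D = s≤s⁻¹ (≤-trans (^-monoʳ-< 2 (s≤s (s≤s z≤n)) (s≤s (m≤m+n j (length r)))) bound′)

  lin-monic : ∀ {m} (c : Vec Bool m) → Monic (2 ^ m) (lin (monic c))
  lin-monic {m} c = Monic-resp lin-monic≡ (Monic-⊕-lower (Monic-σ^ m) lower (≤-reflexive 1+D≡2^m))
    where
    instance _ = m^n≢0 2 m
    D = pred (2 ^ m)
    1+D≡2^m : suc D ≡ 2 ^ m
    1+D≡2^m = suc-pred (2 ^ m)
    cs = Vec.toList c
    lower : Poly≤ D (lin cs)
    lower = Poly≤-lin∘σ^ cs 0 (≤-reflexive (trans (cong (2 ^_) (length-toList c)) (sym 1+D≡2^m)))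
    lin-monic≡ : ∀ x → σ^ m x ⊕ lin cs x ≡ lin (monic c) x
    lin-monic≡ x = sym (begin
      lin (cs ++ true ∷ []) x                    ≡⟨ lin-++ cs (true ∷ []) x ⟩
      lin cs x ⊕ (σ^ (length cs) x ⊕ zeroE)      ≡⟨ cong (lin cs x ⊕_) (⊕-identityʳ _) ⟩
      lin cs x ⊕ σ^ (length cs) x                ≡⟨ cong (λ e → lin cs x ⊕ σ^ e x) (length-toList c) ⟩
      lin cs x ⊕ σ^ m x                          ≡⟨ ⊕-comm _ _ ⟩
      σ^ m x ⊕ lin cs x                          ∎)
      where open ≡-Reasoning

  divide : ∀ {d f} → Monic (suc d) f → ∀ r → ∃ λ q → Monic d q × (∀ x → f x ⊕ f r ≡ (x ⊕ r) · q x)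
  divide {zero} {f} (horner a g (one g≡1) f≡) r = (λ _ → oneE) , one (λ _ → refl) , λ x → begin
    f x ⊕ f r
      ≡⟨ cong₂ _⊕_ (f≡ x) (f≡ r) ⟩
    (a ⊕ x · g x) ⊕ (a ⊕ r · g r)
      ≡⟨ cong₂ (λ u v → (a ⊕ x · u) ⊕ (a ⊕ r · v)) (g≡1 x) (g≡1 r) ⟩
    (a ⊕ x · oneE) ⊕ (a ⊕ r · oneE)
      ≡⟨ solve 3 (λ a x r → (a :+ x :* con true) :+ (a :+ r :* con true) := (x :+ r) :* con true)
           refl a x r ⟩
    (x ⊕ r) · oneE ∎
    where open ≡-Reasoning
  divide {suc d} {f} (horner a g G f≡) r with divide G r
  ... | q , Q , g≡ = (λ x → g r ⊕ x · q x) , horner (g r) q Q (λ _ → refl) , λ x → begin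
    f x ⊕ f r
      ≡⟨ cong₂ _⊕_ (f≡ x) (f≡ r) ⟩
    (a ⊕ x · g x) ⊕ (a ⊕ r · g r)
      ≡⟨ cong (λ t → (a ⊕ x · t) ⊕ (a ⊕ r · g r)) (sym (⊕-cancelʳ (g x) (g r))) ⟩
    (a ⊕ x · ((g x ⊕ g r) ⊕ g r)) ⊕ (a ⊕ r · g r)
      ≡⟨ cong (λ t → (a ⊕ x · (t ⊕ g r)) ⊕ (a ⊕ r · g r)) (g≡ x) ⟩
    (a ⊕ x · ((x ⊕ r) · q x ⊕ g r)) ⊕ (a ⊕ r · g r)
      ≡⟨ solve 5 (λ a x r q g →
           (a :+ x :* ((x :+ r) :* q :+ g)) :+ (a :+ r :* g) := (x :+ r) :* (g :+ x :* q))
           refl a x r (q x) (g r) ⟩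
    (x ⊕ r) · (g r ⊕ x · q x) ∎
    where open ≡-Reasoning

module FiniteField {n : ℕ} (p : El n) (isField : IsField p) where
  open QuotientRing p
  open Frobenius p
  open AlgebraicDegree p
  open PolynomialFunctions p
  open Solver using (solve; _:=_; _:+_; _:*_)
  open Permutation (setoid (El n)) using (foldr-commMonoid)

  x·y≡0⇒x≡0⊎y≡0 : ∀ {x y} → x · y ≡ zeroE → x ≡ zeroE ⊎ y ≡ zeroE
  x·y≡0⇒x≡0⊎y≡0 {x} {y} x·y≡0 with x ≟ zeroE
  ... | yes x≡0 = inj₁ x≡0
  ... | no x≢0 with isField x x≢0
  ...   | x⁻¹ , x·x⁻¹≡1 = inj₂ (begin
    y                ≡⟨ sym (·-identityˡ y) ⟩
    oneE · y         ≡⟨ cong (_· y) (sym x·x⁻¹≡1) ⟩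
    x · x⁻¹ · y      ≡⟨ solve 3 (λ x x⁻¹ y → x :* x⁻¹ :* y := x⁻¹ :* (x :* y)) refl x x⁻¹ y ⟩
    x⁻¹ · (x · y)    ≡⟨ cong (x⁻¹ ·_) x·y≡0 ⟩
    x⁻¹ · zeroE      ≡⟨ ·-zeroʳ x⁻¹ ⟩
    zeroE            ∎)
    where open ≡-Reasoning

  ·-nonzero : ∀ {x y} → x ≢ zeroE → y ≢ zeroE → x · y ≢ zeroE
  ·-nonzero x≢0 y≢0 x·y≡0 = [ x≢0 , y≢0 ]′ (x·y≡0⇒x≡0⊎y≡0 x·y≡0)

  ·-cancelʳ : ∀ {x y z} → z ≢ zeroE → x · z ≡ y · z → x ≡ y
  ·-cancelʳ {x} {y} {z} z≢0 eq = [ ⊕≡zero⇒≡ , ⊥-elim ∘ z≢0 ]′ (x·y≡0⇒x≡0⊎y≡0 (begin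
    (x ⊕ y) · z      ≡⟨ mulAux-⊕ˡ x y z ⟩
    x · z ⊕ y · z    ≡⟨ cong (_⊕ y · z) eq ⟩
    y · z ⊕ y · z    ≡⟨ ⊕-same (y · z) ⟩
    zeroE            ∎))
    where open ≡-Reasoning

  ·-cancelˡ : ∀ {x y z} → z ≢ zeroE → z · x ≡ z · y → x ≡ y
  ·-cancelˡ {x} {y} {z} z≢0 eq = ·-cancelʳ z≢0 (trans (·-comm x z) (trans eq (·-comm z y)))

  ∏ : List (El n) → El n
  ∏ = List.foldr _·_ oneE

  ∏-map-· : ∀ x xs → ∏ (map (x ·_) xs) ≡ powE p x (length xs) · ∏ xs
  ∏-map-· x [] = sym (·-identityˡ oneE)
  ∏-map-· x (y ∷ xs) = trans (cong (x · y ·_) (∏-map-· x xs))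
    (solve 4 (λ x y a b → x :* y :* (a :* b) := x :* a :* (y :* b)) refl x y (powE p x (length xs)) (∏ xs))

  ∏-nonzero : oneE ≢ zeroE → ∀ {xs} → All (_≢ zeroE) xs → ∏ xs ≢ zeroE
  ∏-nonzero 1≢0 [] = 1≢0
  ∏-nonzero 1≢0 (x≢0 ∷ xs≢0) = ·-nonzero x≢0 (∏-nonzero 1≢0 xs≢0)

  map-·-↭ : ∀ {x} → x ≢ zeroE → map (x ·_) (nonzeroVecs n) ↭ nonzeroVecs n
  map-·-↭ {x} x≢0 = ∼bag⇒↭ (unique∧set⇒bag
    (Unique.map⁺ (·-cancelˡ x≢0) (nonzeroVecs-unique n)) (nonzeroVecs-unique n) (mk⇔ to from))
    where
    to : ∀ {y} → y ∈ map (x ·_) (nonzeroVecs n) → y ∈ nonzeroVecs n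
    to y∈ with ∈-map⁻ (x ·_) y∈
    ... | w , w∈ , refl = ∈-nonzeroVecs (·-nonzero x≢0 (All.lookup (nonzeroVecs-nonzero n) w∈))
    from : ∀ {y} → y ∈ nonzeroVecs n → y ∈ map (x ·_) (nonzeroVecs n)
    from {y} y∈ with isField x x≢0
    ... | x⁻¹ , x·x⁻¹≡1 =
      subst (_∈ map (x ·_) (nonzeroVecs n)) x·x⁻¹y≡y (∈-map⁺ (x ·_) (∈-nonzeroVecs x⁻¹y≢0))
      where
      open ≡-Reasoning
      x·x⁻¹y≡y : x · (x⁻¹ · y) ≡ y
      x·x⁻¹y≡y = trans (sym (·-assoc x x⁻¹ y)) (trans (cong (_· y) x·x⁻¹≡1) (·-identityˡ y))
      x⁻¹y≢0 : x⁻¹ · y ≢ zeroE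
      x⁻¹y≢0 x⁻¹y≡0 = All.lookup (nonzeroVecs-nonzero n) y∈ (begin
        y               ≡⟨ sym x·x⁻¹y≡y ⟩
        x · (x⁻¹ · y)   ≡⟨ cong (x ·_) x⁻¹y≡0 ⟩
        x · zeroE       ≡⟨ ·-zeroʳ x ⟩
        zeroE           ∎)

  -- Multiplication by x ≠ 0 permutes the nonzero elements, so comparing
  -- products gives x ^ (2ⁿ - 1) = 1.
  fermat : ∀ x → powE p x (2 ^ n) ≡ x
  fermat x with x ≟ zeroE
  ... | yes refl =
    subst (λ e → powE p zeroE e ≡ zeroE) (length-nonzeroVecs n) (·-zeroˡ (powE p zeroE (length (nonzeroVecs n))))
  ... | no x≢0 = begin
    powE p x (2 ^ n)                          ≡⟨ cong (powE p x) (sym (length-nonzeroVecs n)) ⟩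
    x · powE p x (length (nonzeroVecs n))     ≡⟨ cong (x ·_) x^[2ⁿ-1]≡1 ⟩
    x · oneE                                  ≡⟨ ·-identityʳ x ⟩
    x                                         ∎
    where
    open ≡-Reasoning
    1≢0 : oneE ≢ zeroE
    1≢0 1≡0 = x≢0 (trans (sym (·-identityʳ x)) (trans (cong (x ·_) 1≡0) (·-zeroʳ x)))
    P = ∏ (nonzeroVecs n)
    x^[2ⁿ-1]≡1 : powE p x (length (nonzeroVecs n)) ≡ oneE
    x^[2ⁿ-1]≡1 = ·-cancelʳ (∏-nonzero 1≢0 (nonzeroVecs-nonzero n)) (begin
      powE p x (length (nonzeroVecs n)) · P   ≡⟨ sym (∏-map-· x (nonzeroVecs n)) ⟩
      ∏ (map (x ·_) (nonzeroVecs n))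
        ≡⟨ foldr-commMonoid ·-isCommutativeMonoid (↭⇒↭ₛ (map-·-↭ x≢0)) ⟩
      P                                       ≡⟨ sym (·-identityˡ P) ⟩
      oneE · P                                ∎)

  σ^n≡id : ∀ x → σ^ n x ≡ x
  σ^n≡id x = trans (σ^≡powE n x) (fermat x)

  lin∘lin≡zeroE : ∀ g h → (∀ i → coeff (polyMul g h) i ≡ coeffXn-1 n i) → ∀ x → lin g (lin h x) ≡ zeroE
  lin∘lin≡zeroE g h gh≈ x = begin
    lin g (lin h x)                ≡⟨ sym (lin-polyMul g h x) ⟩
    lin (polyMul g h) x            ≡⟨ lin-cong (polyMul g h) (Xⁿ+1 n) gh≈Xⁿ+1 x ⟩
    lin (Xⁿ+1 n) x                 ≡⟨ lin-polyAdd (true ∷ []) (Xpow n) x ⟩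
    (x ⊕ zeroE) ⊕ lin (Xpow n) x   ≡⟨ cong₂ _⊕_ (⊕-identityʳ x) (trans (lin-Xpow n x) (σ^n≡id x)) ⟩
    x ⊕ x                          ≡⟨ ⊕-same x ⟩
    zeroE                          ∎
    where
    open ≡-Reasoning
    gh≈Xⁿ+1 : polyMul g h ≈ₚ Xⁿ+1 n
    gh≈Xⁿ+1 i = trans (gh≈ i) (sym (Xⁿ+1≈ n i))

  Finv-·σ : 1 ≤ n → ∀ e → Finv p e · σ e ≡ e
  Finv-·σ 1≤n e = begin
    powE p e (2 ^ n ∸ 2) · (e · e)
      ≡⟨ cong (λ t → powE p e (2 ^ n ∸ 2) · (e · t)) (sym (·-identityʳ e)) ⟩
    powE p e (2 ^ n ∸ 2) · powE p e 2       ≡⟨ sym (powE-+ e (2 ^ n ∸ 2) 2) ⟩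
    powE p e (2 ^ n ∸ 2 + 2)                ≡⟨ cong (powE p e) (m∸n+n≡m (^-monoʳ-≤ 2 1≤n)) ⟩
    powE p e (2 ^ n)                        ≡⟨ fermat e ⟩
    e                                       ∎
    where open ≡-Reasoning

  Finv-zeroE : 2 ≤ n → Finv p zeroE ≡ zeroE
  Finv-zeroE 2≤n = powE-zeroE (m<n⇒0<n∸m (≤-trans (n≤1+n 3) (^-monoʳ-≤ 2 2≤n)))
    where
    powE-zeroE : ∀ {e} → 0 < e → powE p zeroE e ≡ zeroE
    powE-zeroE {suc e} _ = ·-zeroˡ (powE p zeroE e)

  Finv-on-kernel : 2 ≤ n → ∀ r e → lin (true ∷ false ∷ r) e ≡ zeroE → Finv p e ≡ Q r e
  Finv-on-kernel 2≤n r e e∈ker with e ≟ zeroE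
  ... | yes refl = trans (Finv-zeroE 2≤n) (sym (Q-zeroE r))
  ... | no e≢0 = ·-cancelʳ (·-nonzero e≢0 e≢0) (begin
    Finv p e · σ e         ≡⟨ Finv-·σ (≤-trans (s≤s z≤n) 2≤n) e ⟩
    e                      ≡⟨ ⊕≡zero⇒≡ (trans (cong (e ⊕_) (sym (⊕-identityˡ _))) e∈ker) ⟩
    lin r (σ (σ e))        ≡⟨ sym (Q-·σ r e) ⟩
    Q r e · σ e            ∎)
    where open ≡-Reasoning

  root-bound : 1 ≤ n → ∀ {d f} → Monic d f →
    ∀ rs → Unique rs → All (λ r → f r ≡ zeroE) rs → length rs ≤ d
  root-bound _ F [] _ _ = z≤n
  root-bound 1≤n (one f≡1) (r ∷ rs) _ (fr≡0 ∷ _) = ⊥-elim (oneE≢zeroE 1≤n (trans (sym (f≡1 r)) fr≡0))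
    where
    oneE≢zeroE : 1 ≤ n → oneE ≢ zeroE
    oneE≢zeroE (s≤s _) 1≡0 with trans (sym oneE≡unitVec) 1≡0
    ... | ()
  root-bound 1≤n {suc d} {f} F (r ∷ rs) (r∉rs ∷ rs-unique) (fr≡0 ∷ fs≡0) with divide F r
  ... | q , Q , f≡ = s≤s (root-bound 1≤n Q rs rs-unique (roots-of-q r∉rs fs≡0))
    where
    roots-of-q : ∀ {ys} → All (r ≢_) ys → All (λ y → f y ≡ zeroE) ys → All (λ y → q y ≡ zeroE) ys
    roots-of-q [] [] = []
    roots-of-q {y ∷ _} (r≢y ∷ r≢ys) (fy≡0 ∷ fys≡0) =
      [ ⊥-elim ∘ r≢y ∘ sym ∘ ⊕≡zero⇒≡ , id ]′ (x·y≡0⇒x≡0⊎y≡0 (begin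
        (y ⊕ r) · q y   ≡⟨ sym (f≡ y) ⟩
        f y ⊕ f r       ≡⟨ cong₂ _⊕_ fy≡0 fr≡0 ⟩
        zeroE ⊕ zeroE   ≡⟨ ⊕-same zeroE ⟩
        zeroE           ∎))
      ∷ roots-of-q r≢ys fys≡0
      where open ≡-Reasoning

  lin-kernel-dim≤ : 1 ≤ n → ∀ {m} (c : Vec Bool m) h → monic c ≈ₚ h →
    ∀ {s} {ws : Vec (El n) s} → LinIndep ws → VAll (λ w → lin h w ≡ zeroE) ws → s ≤ m
  lin-kernel-dim≤ 1≤n {m} c h c≈h {s} {ws} ind ws∈ker =
    ≮⇒≥ λ m<s → <⇒≱ (^-monoʳ-< 2 (s≤s (s≤s z≤n)) m<s) 2^s≤2^m
    where
    2^s≤2^m : 2 ^ s ≤ 2 ^ m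
    2^s≤2^m = subst (_≤ 2 ^ m) (trans (length-map (comb ws) (allVecs s)) (length-allVecs s))
      (root-bound 1≤n (Monic-resp (lin-cong (monic c) h c≈h) (lin-monic c)) (map (comb ws) (allVecs s))
        (Unique.map⁺ (comb-injective {vs = ws} ind) (allVecs-unique s))
        (All.map⁺ (All.universal (lin-comb-kernel h ws∈ker) (allVecs s))))

  lin-kernel-dim≥ : 1 ≤ n → ∀ {k m} g h (c : Vec Bool m) → monic c ≈ₚ h → k + m ≡ n →
    (∀ i → coeff (polyMul g h) i ≡ coeffXn-1 n i) →
    ∃ λ (us : Vec (El n) k) → LinIndep us × VAll (λ u → lin g u ≡ zeroE) us
  lin-kernel-dim≥ 1≤n {k} {m} g h c c≈h k+m≡n gh≈ =
    independent-subfamily k≤rank (Vec.map (lin h) preimages) image-independent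
      (VAll.map⁺ (VAll.universal (lin∘lin≡zeroE g h gh≈) preimages))
    where
    open RankNullity (lin h) (lin-⊕ h)
    open Split (rankNullity (standardBasis n) (standardBasis-independent n))
    k≤rank : k ≤ rank
    k≤rank = +-cancelʳ-≤ m k rank (begin
      k + m          ≡⟨ trans k+m≡n (sym rank+nullity) ⟩
      rank + nullity ≤⟨ +-monoʳ-≤ rank (lin-kernel-dim≤ 1≤n c h c≈h kernel-independent kernel-⊆) ⟩
      rank + m       ∎)
      where open ≤-Reasoning

  affineSum-Finv-vanishes : 2 ≤ n → ∀ r {k} (us : Vec (El n) (suc k)) →
    VAll (λ u → lin (true ∷ false ∷ r) u ≡ zeroE) us → length r ≤ k → affineSum (Finv p) zeroE us ≡ zeroE
  affineSum-Finv-vanishes 2≤n r us us∈ker r≤k =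
    trans (∑-cong Finv≡Q)
          (∑-vanishes (below (Degree≤-mono r≤k (Degree≤-Q (Degree≤-comb us) r))))
    where
    Finv≡Q : ∀ c → Finv p (zeroE ⊕ comb us c) ≡ Q r (comb us c)
    Finv≡Q c = trans (cong (Finv p) (⊕-identityˡ _))
                     (Finv-on-kernel 2≤n r _ (lin-comb-kernel (true ∷ false ∷ r) us∈ker c))

  Finv-not-sumFree : 1 ≤ n → ∀ {k} (c : Vec Bool k) h →
    (∀ i → coeff (polyMul (true ∷ false ∷ monic c) h) i ≡ coeffXn-1 n i) → ¬ SumFree (2 + k) (Finv p)
  Finv-not-sumFree 1≤n c h gh≈ sumFree
    with cofactor-monic 1≤n (s≤s z≤n) (true ∷ false ∷ c) h gh≈
  ... | m , c' , c'≈h , k+m≡n with lin-kernel-dim≥ 1≤n (true ∷ false ∷ monic c) h c' c'≈h k+m≡n gh≈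
  ...   | us , us-independent , us∈ker =
    sumFree zeroE us us-independent (affineSum-Finv-vanishes 2≤n (monic c) us us∈ker (≤-reflexive (length-monic c)))
    where
    2≤n : 2 ≤ n
    2≤n = subst (2 ≤_) k+m≡n (s≤s (s≤s z≤n))

corollary3p2 : (n k : ℕ) → 1 ≤ n → 1 ≤ k
    → (p : Vec Bool n) → IsField p
    → (c : Vec Bool k) → coeff (monic c) 1 ≡ false → DividesXn-1 n (monic c)
    → ¬ SumFree k (Finv p)
corollary3p2 n 1 _ _ p _ (_ ∷ []) () _
corollary3p2 n (suc (suc k)) 1≤n 1≤k p _ (false ∷ false ∷ c) refl (h , gh≈)
  with constant-term 1≤n 1≤k (false ∷ false ∷ c) h gh≈
... | ()
corollary3p2 n (suc (suc k)) 1≤n 1≤k p isField (true ∷ false ∷ c) refl (h , gh≈) =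
  FiniteField.Finv-not-sumFree p isField 1≤n c h gh≈
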